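{- Let $X$ be a finite simplicial complex with vertices $v_1,\dots,v_m$ and let $\varepsilon\in\mathbb{Z}_2^m$ with $\varepsilon\neq(0,\dots,0)$. Then the subgraph $I(X,\varepsilon)$ of the face poset $\mathcal{P}(X)$ is a discrete Morse matching if and only if $\varepsilon$ is dalmatian.
   Context: $\mathbb{F}$ is the field with two elements. A colouring $\varepsilon\in\mathbb{Z}_2^m$ colours $v_i$ black if $\varepsilon(i)=1$ and white otherwise. The horizontal differential $\partial_h$ on the simplicial chain complex $C_*(X)$ over $\mathbb{F}$ sends a simplex $\sigma$ to the sum of the faces $\sigma\setminus\{v\}$ over the black vertices $v$ of $\sigma$. The face poset $\mathcal{P}(X)$ is the directed graph whose vertices are the nonempty simplices of $X$, with an edge from $\sigma$ to $\tau$ whenever $\tau\subset\sigma$ and $\dim\tau=\dim\sigma-1$. $I(X,\varepsilon)$ is the subgraph of $\mathcal{P}(X)$ consisting of the edges $\sigma\to\tau$ such that $\tau$ appears with nonzero coefficient in $\partial_h(\sigma)$. A matching on a graph is a set of pairwise disjoint edges (no two sharing an endpoint); a matching on $\mathcal{P}(X)$ is a (discrete) Morse matching if reversing the orientation of its edges creates no directed cycle in $\mathcal{P}(X)$. A colouring $\varepsilon\neq(0,\dots,0)$ is dalmatian if for every pair of simplices $\sigma,\tau$ of $X$ with $\sigma\cap\tau\neq\emptyset$, the vertex set of $\sigma\cup\tau$ contains at most one black vertex (equivalently, the closed stars of the black vertices are pairwise disjoint). -}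

module Defs where

open import Data.Nat using (ℕ; suc)
open import Data.Bool using (Bool; true; false; _∧_; _xor_)
import Data.Bool as Bool
open import Data.Fin using (Fin)
open import Data.Fin.Subset
open import Data.Fin.Subset.Properties using (_∈?_)
open import Data.Vec using (Vec; lookup; allFin; foldr′; map)
open import Data.Vec.Properties using (≡-dec)
open import Data.Product using (_×_; ∃; Σ-syntax)
open import Data.Sum using (_⊎_)
open import Relation.Nullary using (¬_)
open import Relation.Nullary.Decidable using (⌊_⌋)
open import Relation.Binary.PropositionalEquality using (_≡_)
open import Relation.Binary.Construct.Closure.Transitive using (TransClosure)
open import Level using (0ℓ)

record SimplicialComplex (m : ℕ) : Set₁ where
  field
    face        : Subset m → Set
    down-closed : ∀ {σ τ} → face σ → τ ⊆ σ → face τ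
    vertex      : ∀ (i : Fin m) → face ⁅ i ⁆
open SimplicialComplex public

-- A colouring ε ∈ ℤ₂^m, encoded as a bit vector; v_i is black iff ε(i) = 1 (true).
Colouring : ℕ → Set
Colouring m = Vec Bool m

black : ∀ {m} → Colouring m → Fin m → Bool
black ε i = lookup ε i

-- Coefficient (in 𝔽 = ℤ/2, encoded as Bool with xor as addition) of the simplex τ
-- in ∂_h(σ) = Σ_{v ∈ σ black} (σ ∖ {v}).
∂h-coeff : ∀ {m} → Colouring m → Subset m → Subset m → Bool
∂h-coeff {m} ε σ τ =
  foldr′ _xor_ false
    (map (λ i → (⌊ i ∈? σ ⌋ ∧ black ε i) ∧ ⌊ ≡-dec Bool._≟_ (σ - i) τ ⌋) (allFin m))

PEdge : ∀ {m} → SimplicialComplex m → Subset m → Subset m → Set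
PEdge X σ τ = face X σ × face X τ × Nonempty σ × Nonempty τ × τ ⊆ σ × suc ∣ τ ∣ ≡ ∣ σ ∣

IEdge : ∀ {m} → SimplicialComplex m → Colouring m → Subset m → Subset m → Set
IEdge X ε σ τ = PEdge X σ τ × ∂h-coeff ε σ τ ≡ true

IsMatching : ∀ {m} → (Subset m → Subset m → Set) → Set
IsMatching M = ∀ {a b c d} → M a b → M c d →
  (a ≡ c ⊎ a ≡ d ⊎ b ≡ c ⊎ b ≡ d) → a ≡ c × b ≡ d

ReversedStep : ∀ {m} → SimplicialComplex m → (Subset m → Subset m → Set) →
               Subset m → Subset m → Set
ReversedStep X M a b = (PEdge X a b × ¬ M a b) ⊎ M b a

IsMorseMatching : ∀ {m} → SimplicialComplex m → (Subset m → Subset m → Set) → Set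
IsMorseMatching X M =
  (∀ {a b} → M a b → PEdge X a b) ×
  IsMatching M ×
  ¬ (∃ λ a → TransClosure (ReversedStep X M) a a)

Dalmatian : ∀ {m} → SimplicialComplex m → Colouring m → Set
Dalmatian {m} X ε =
  ¬ (ε ≡ ⊥) ×
  (∀ σ τ → face X σ → face X τ → Nonempty (σ ∩ τ) →
     ∀ (i j : Fin m) → i ∈ (σ ∪ τ) → j ∈ (σ ∪ τ) →
     black ε i ≡ true → black ε j ≡ true → i ≡ j)

-- Over 𝔽₂ the coefficient of τ in ∂_h σ counts the black vertices v of σ
-- with σ ∖ {v} = τ; there is at most one such v, so σ → τ lies in I(X, ε)
-- exactly when τ is σ with one black vertex deleted.
--
-- If I(X, ε) is a matching, two black vertices at distance at most 2 in the
-- 1-skeleton coincide: an edge {i, j} with i, j black has two I-edges leaving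
-- it, and edges {i, k}, {j, k} with i, j black have two I-edges entering {k}.
-- Every vertex of σ ∪ τ is at distance at most 1 from a common vertex of σ and
-- τ, so ε is dalmatian.
--
-- Conversely, if ε is dalmatian, two I-edges sharing an endpoint run between
-- simplices sharing a vertex, so they delete the same black vertex and
-- coincide. Acyclicity comes from the height |σ| + 2·[σ has no black vertex]:
-- it drops by 1 along each unmatched edge of 𝒫(X) (a black vertex of σ
-- survives in τ, otherwise σ → τ would be matched) and by 1 along each
-- reversed matched edge (deleting the unique black vertex of σ adds 2).
module Submission where

open import Defs
open import Data.Nat using (ℕ; zero; suc; _+_; _<_; _≤_; s≤s)
open import Data.Nat.Properties using (≤-reflexive; <-irrefl; <-trans; <⇒≱; suc-injective)
open import Data.Bool using (Bool; true; false; not; _∧_; _xor_)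
import Data.Bool as Bool
open import Data.Bool.Properties using (¬-not; T-≡; T-∧)
open import Data.Fin using (Fin; zero; suc; _≟_)
open import Data.Fin.Properties using (any?; 0≢1+n) renaming (suc-injective to Fin-suc-injective)
open import Data.Fin.Subset
  using (Subset; inside; outside; _∈_; _∉_; _⊆_; _─_; _-_; _∩_; _∪_; ⁅_⁆; ∣_∣; Nonempty; ⊥)
open import Data.Fin.Subset.Properties
  using (_∈?_; ⊆-antisym; ⊆-trans; ⊆-reflexive; x∈⁅x⁆; x∈⁅y⁆⇒x≡y; x∉⁅y⁆⇒x≢y;
         x∈p∪q⁺; x∈p∪q⁻; x∈p∩q⁺; x∈p∩q⁻; p⊂q⇒∣p∣<∣q∣; p─⊥≡p; p─q⊆p; x∈p∧x≢y⇒x∈p-y)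
open import Data.Vec using (_∷_; foldr′; tabulate; here; there)
open import Data.Vec.Properties using (≡-dec; tabulate-allFin)
open import Data.Product using (_×_; _,_; ∃; proj₁; proj₂)
open import Data.Sum using (_⊎_; inj₁; inj₂)
open import Data.Empty using (⊥-elim)
open import Function using (_∘_)
open import Function.Bundles using (_⇔_; mk⇔; Equivalence)
open import Relation.Nullary using (¬_; Dec; yes; no; _×-dec_)
open import Relation.Nullary.Decidable using (⌊_⌋; toWitness; fromWitness; decidable-stable)
open import Relation.Binary.PropositionalEquality using (_≡_; _≢_; refl; sym; trans; cong; subst)
open import Relation.Binary.Construct.Closure.Transitive using (TransClosure; [_]; _∷_)

open Equivalence

private
  variable
    n : ℕ
    p q : Subset n
    x y : Fin n

x∈p─q⇒x∉q : ∀ (p q : Subset n) → x ∈ p ─ q → x ∉ q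
x∈p─q⇒x∉q (_ ∷ p) (inside ∷ q) () here
x∈p─q⇒x∉q (_ ∷ p) (_ ∷ q) (there x∈p─q) (there x∈q) = x∈p─q⇒x∉q p q x∈p─q x∈q

x∈p-y⇒x≢y : x ∈ p - y → x ≢ y
x∈p-y⇒x≢y {p = p} {y = y} x∈p-y = x∉⁅y⁆⇒x≢y (x∈p─q⇒x∉q p ⁅ y ⁆ x∈p-y)

x∉p-x : x ∉ p - x
x∉p-x x∈p-x = x∈p-y⇒x≢y x∈p-x refl

x∈p⇒suc∣p-x∣≡∣p∣ : x ∈ p → suc ∣ p - x ∣ ≡ ∣ p ∣
x∈p⇒suc∣p-x∣≡∣p∣ {p = inside ∷ p} here = cong (suc ∘ ∣_∣) (p─⊥≡p p)
x∈p⇒suc∣p-x∣≡∣p∣ {p = inside ∷ p} (there x∈p) = cong suc (x∈p⇒suc∣p-x∣≡∣p∣ x∈p)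
x∈p⇒suc∣p-x∣≡∣p∣ {p = outside ∷ p} (there x∈p) = x∈p⇒suc∣p-x∣≡∣p∣ x∈p

p-x≡p-y⇒x≡y : x ∈ p → p - x ≡ p - y → x ≡ y
p-x≡p-y⇒x≡y {x = x} {y = y} x∈p eq = decidable-stable (x ≟ y) λ x≢y →
  x∉p-x (subst (x ∈_) (sym eq) (x∈p∧x≢y⇒x∈p-y x∈p x≢y))

p-x⊆q∧x∈q⇒p⊆q : p - x ⊆ q → x ∈ q → p ⊆ q
p-x⊆q∧x∈q⇒p⊆q {x = x} p-x⊆q x∈q {y} y∈p with y ≟ x
... | yes refl = x∈q
... | no y≢x = p-x⊆q (x∈p∧x≢y⇒x∈p-y y∈p y≢x)

p-x-injective : x ∈ p → x ∈ q → p - x ≡ q - x → p ≡ q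
p-x-injective {x = x} {p} {q} x∈p x∈q eq = ⊆-antisym
  (p-x⊆q∧x∈q⇒p⊆q (⊆-trans (⊆-reflexive eq) (p─q⊆p q ⁅ x ⁆)) x∈q)
  (p-x⊆q∧x∈q⇒p⊆q (⊆-trans (⊆-reflexive (sym eq)) (p─q⊆p p ⁅ x ⁆)) x∈p)

p⊆q∧∣q∣≤∣p∣⇒p≡q : p ⊆ q → ∣ q ∣ ≤ ∣ p ∣ → p ≡ q
p⊆q∧∣q∣≤∣p∣⇒p≡q {p = p} p⊆q ∣q∣≤∣p∣ = ⊆-antisym p⊆q λ {x} x∈q →
  decidable-stable (x ∈? p) λ x∉p → <⇒≱ (p⊂q⇒∣p∣<∣q∣ (p⊆q , x , x∈q , x∉p)) ∣q∣≤∣p∣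

⁅x⁆∪⁅y⁆-x≡⁅y⁆ : x ≢ y → ⁅ x ⁆ ∪ ⁅ y ⁆ - x ≡ ⁅ y ⁆
⁅x⁆∪⁅y⁆-x≡⁅y⁆ {x = x} {y = y} x≢y = ⊆-antisym ⊆⁅y⁆ ⁅y⁆⊆
  where
  ⊆⁅y⁆ : ⁅ x ⁆ ∪ ⁅ y ⁆ - x ⊆ ⁅ y ⁆
  ⊆⁅y⁆ z∈ with x∈p∪q⁻ ⁅ x ⁆ ⁅ y ⁆ (p─q⊆p _ ⁅ x ⁆ z∈)
  ... | inj₁ z∈⁅x⁆ = ⊥-elim (x∈p-y⇒x≢y z∈ (x∈⁅y⁆⇒x≡y x z∈⁅x⁆))
  ... | inj₂ z∈⁅y⁆ = z∈⁅y⁆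
  ⁅y⁆⊆ : ⁅ y ⁆ ⊆ ⁅ x ⁆ ∪ ⁅ y ⁆ - x
  ⁅y⁆⊆ z∈⁅y⁆ with x∈⁅y⁆⇒x≡y y z∈⁅y⁆
  ... | refl = x∈p∧x≢y⇒x∈p-y (x∈p∪q⁺ (inj₂ z∈⁅y⁆)) (x≢y ∘ sym)

xor-sum : (Fin n → Bool) → Bool
xor-sum g = foldr′ _xor_ false (tabulate g)

xor-sum-true⇒∃ : (g : Fin n → Bool) → xor-sum g ≡ true → ∃ λ i → g i ≡ true
xor-sum-true⇒∃ {zero} g ()
xor-sum-true⇒∃ {suc n} g sum≡true with g zero in g0
... | true = zero , g0
... | false with xor-sum-true⇒∃ (g ∘ suc) sum≡true
...   | i , gi = suc i , gi

xor-sum-false : (g : Fin n → Bool) → (∀ i → g i ≡ false) → xor-sum g ≡ false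
xor-sum-false {zero} g _ = refl
xor-sum-false {suc n} g all-false rewrite all-false zero = xor-sum-false (g ∘ suc) (all-false ∘ suc)

xor-sum-single : (g : Fin n → Bool) (i : Fin n) → g i ≡ true →
                 (∀ j → g j ≡ true → j ≡ i) → xor-sum g ≡ true
xor-sum-single {suc n} g zero gi only rewrite gi =
  cong not (xor-sum-false (g ∘ suc) λ j → ¬-not (λ gj → 0≢1+n (sym (only (suc j) gj))))
xor-sum-single {suc n} g (suc i) gi only with g zero in g0
... | true with () ← only zero g0
... | false = xor-sum-single (g ∘ suc) i gi λ j gj → Fin-suc-injective (only (suc j) gj)

BlackFacet : ∀ {m} → Colouring m → Subset m → Subset m → Set
BlackFacet ε σ τ = ∃ λ i → i ∈ σ × black ε i ≡ true × σ - i ≡ τ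

module _ {m : ℕ} (ε : Colouring m) (σ τ : Subset m) where

  private
    term : Fin m → Bool
    term i = (⌊ i ∈? σ ⌋ ∧ black ε i) ∧ ⌊ ≡-dec Bool._≟_ (σ - i) τ ⌋

    term-true⇔ : ∀ i → term i ≡ true ⇔ (i ∈ σ × black ε i ≡ true × σ - i ≡ τ)
    term-true⇔ i = mk⇔ split join
      where
      member : Dec (i ∈ σ)
      member = i ∈? σ
      deletes? : Dec (σ - i ≡ τ)
      deletes? = ≡-dec Bool._≟_ (σ - i) τ
      split : term i ≡ true → i ∈ σ × black ε i ≡ true × σ - i ≡ τ
      split t with to (T-∧ {⌊ member ⌋ ∧ black ε i}) (from (T-≡ {term i}) t)
      ... | i∈σ∧black , deletes with to (T-∧ {⌊ member ⌋}) i∈σ∧black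
      ...   | i∈σ , is-black =
        toWitness {a? = member} i∈σ , to T-≡ is-black , toWitness {a? = deletes?} deletes
      join : i ∈ σ × black ε i ≡ true × σ - i ≡ τ → term i ≡ true
      join (i∈σ , is-black , deletes) = to (T-≡ {term i})
        (from T-∧ ( from T-∧ (fromWitness {a? = member} i∈σ , from T-≡ is-black)
                  , fromWitness {a? = deletes?} deletes ))

  ∂h-coeff≡true⇔BlackFacet : ∂h-coeff ε σ τ ≡ true ⇔ BlackFacet ε σ τ
  ∂h-coeff≡true⇔BlackFacet = mk⇔ coeff⇒facet facet⇒coeff
    where
    coeff≡xor-sum : ∂h-coeff ε σ τ ≡ xor-sum term
    coeff≡xor-sum = cong (foldr′ _xor_ false) (sym (tabulate-allFin term))
    coeff⇒facet : ∂h-coeff ε σ τ ≡ true → BlackFacet ε σ τ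
    coeff⇒facet c with xor-sum-true⇒∃ term (trans (sym coeff≡xor-sum) c)
    ... | i , ti = i , to (term-true⇔ i) ti
    facet⇒coeff : BlackFacet ε σ τ → ∂h-coeff ε σ τ ≡ true
    facet⇒coeff (i , facet) =
      trans coeff≡xor-sum (xor-sum-single term i (from (term-true⇔ i) facet) only-i)
      where
      only-i : ∀ j → term j ≡ true → j ≡ i
      only-i j tj with to (term-true⇔ j) tj
      ... | j∈σ , _ , σ-j≡τ = p-x≡p-y⇒x≡y j∈σ (trans σ-j≡τ (sym (proj₂ (proj₂ facet))))

DalmatianCondition : ∀ {m} → SimplicialComplex m → Colouring m → Set
DalmatianCondition {m} X ε =
  ∀ σ τ → face X σ → face X τ → Nonempty (σ ∩ τ) →
  ∀ (i j : Fin m) → i ∈ (σ ∪ τ) → j ∈ (σ ∪ τ) →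
  black ε i ≡ true → black ε j ≡ true → i ≡ j

ShareEndpoint : Subset n → Subset n → Subset n → Subset n → Set
ShareEndpoint a b c d = a ≡ c ⊎ a ≡ d ⊎ b ≡ c ⊎ b ≡ d

shareEndpoint⇒⊆ : ∀ {a b c d : Subset n} → b ⊆ a → d ⊆ c → ShareEndpoint a b c d → b ⊆ c
shareEndpoint⇒⊆ b⊆a d⊆c (inj₁ refl) = b⊆a
shareEndpoint⇒⊆ b⊆a d⊆c (inj₂ (inj₁ refl)) = d⊆c ∘ b⊆a
shareEndpoint⇒⊆ b⊆a d⊆c (inj₂ (inj₂ (inj₁ refl))) = ⊆-reflexive refl
shareEndpoint⇒⊆ b⊆a d⊆c (inj₂ (inj₂ (inj₂ refl))) = d⊆c

deletions-shareEndpoint⇒≡ : x ∈ p → x ∈ q → ShareEndpoint p (p - x) q (q - x) → p ≡ q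
deletions-shareEndpoint⇒≡ x∈p x∈q (inj₁ p≡q) = p≡q
deletions-shareEndpoint⇒≡ x∈p x∈q (inj₂ (inj₁ refl)) = ⊥-elim (x∉p-x x∈p)
deletions-shareEndpoint⇒≡ x∈p x∈q (inj₂ (inj₂ (inj₁ refl))) = ⊥-elim (x∉p-x x∈q)
deletions-shareEndpoint⇒≡ x∈p x∈q (inj₂ (inj₂ (inj₂ eq))) = p-x-injective x∈p x∈q eq

<-measure⇒acyclic : ∀ {A : Set} {R : A → A → Set} (h : A → ℕ) →
                    (∀ {a b} → R a b → h b < h a) → ¬ (∃ λ a → TransClosure R a a)
<-measure⇒acyclic {R = R} h decreasing (a , cycle) = <-irrefl refl (descend cycle)
  where
  descend : ∀ {a b} → TransClosure R a b → h b < h a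
  descend [ r ] = decreasing r
  descend (r ∷ rs) = <-trans (descend rs) (decreasing r)

penalty : ∀ {P : Set} → Dec P → ℕ
penalty (yes _) = 0
penalty (no _) = 2

module _ {m : ℕ} (X : SimplicialComplex m) (ε : Colouring m) where

  private
    variable
      a b : Subset m
      i j k : Fin m

  IEdge⇒BlackFacet : IEdge X ε a b → BlackFacet ε a b
  IEdge⇒BlackFacet {a} {b} = to (∂h-coeff≡true⇔BlackFacet ε a b) ∘ proj₂

  black-deletion-IEdge : face X a → i ∈ a → black ε i ≡ true → Nonempty (a - i) → IEdge X ε a (a - i)
  black-deletion-IEdge {a} {i} fa i∈a is-black nonempty =
    ( fa , down-closed X fa (p─q⊆p a ⁅ i ⁆) , (i , i∈a) , nonempty
    , p─q⊆p a ⁅ i ⁆ , x∈p⇒suc∣p-x∣≡∣p∣ i∈a )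
    , from (∂h-coeff≡true⇔BlackFacet ε a (a - i)) (i , i∈a , is-black , refl)

  Adjacent : Fin m → Fin m → Set
  Adjacent i k = face X (⁅ i ⁆ ∪ ⁅ k ⁆)

  face⇒Adjacent : face X a → i ∈ a → k ∈ a → Adjacent i k
  face⇒Adjacent {a} {i} {k} fa i∈a k∈a = down-closed X fa ⊆a
    where
    ⊆a : ⁅ i ⁆ ∪ ⁅ k ⁆ ⊆ a
    ⊆a z∈ with x∈p∪q⁻ ⁅ i ⁆ ⁅ k ⁆ z∈
    ... | inj₁ z∈⁅i⁆ rewrite x∈⁅y⁆⇒x≡y i z∈⁅i⁆ = i∈a
    ... | inj₂ z∈⁅k⁆ rewrite x∈⁅y⁆⇒x≡y k z∈⁅k⁆ = k∈a

  edge-deletion-IEdge : Adjacent i k → i ≢ k → black ε i ≡ true →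
                        IEdge X ε (⁅ i ⁆ ∪ ⁅ k ⁆) (⁅ i ⁆ ∪ ⁅ k ⁆ - i)
  edge-deletion-IEdge {i} {k} adj i≢k bi = black-deletion-IEdge adj (x∈p∪q⁺ (inj₁ (x∈⁅x⁆ i))) bi
    (k , x∈p∧x≢y⇒x∈p-y (x∈p∪q⁺ (inj₂ (x∈⁅x⁆ k))) (i≢k ∘ sym))

  module _ (matching : IsMatching (IEdge X ε)) where

    -- The two black deletions of the edge {i, j} both leave it.
    adjacent-blacks-≡ : Adjacent i j → black ε i ≡ true → black ε j ≡ true → i ≡ j
    adjacent-blacks-≡ {i} {j} adj bi bj = decidable-stable (i ≟ j) λ i≢j →
      let i∈e = x∈p∪q⁺ (inj₁ (x∈⁅x⁆ i))
          j∈e = x∈p∪q⁺ (inj₂ (x∈⁅x⁆ j))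
          from-i = edge-deletion-IEdge adj i≢j bi
          from-j = black-deletion-IEdge adj j∈e bj (i , x∈p∧x≢y⇒x∈p-y i∈e i≢j)
      in i≢j (p-x≡p-y⇒x≡y i∈e (proj₂ (matching from-i from-j (inj₁ refl))))

    -- The black deletions of the edges {i, k} and {j, k} both enter {k}.
    distance-2-blacks-≡ : Adjacent i k → Adjacent j k → black ε i ≡ true → black ε j ≡ true → i ≡ j
    distance-2-blacks-≡ {i} {k} {j} adj-ik adj-jk bi bj with i ≟ k | j ≟ k
    ... | yes refl | _ = sym (adjacent-blacks-≡ adj-jk bj bi)
    ... | no _ | yes refl = adjacent-blacks-≡ adj-ik bi bj
    ... | no i≢k | no j≢k
      with matching (edge-deletion-IEdge adj-ik i≢k bi) (edge-deletion-IEdge adj-jk j≢k bj)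
                    (inj₂ (inj₂ (inj₂ (trans (⁅x⁆∪⁅y⁆-x≡⁅y⁆ i≢k) (sym (⁅x⁆∪⁅y⁆-x≡⁅y⁆ j≢k))))))
    ...   | same-edge , _ with x∈p∪q⁻ ⁅ j ⁆ ⁅ k ⁆ (subst (i ∈_) same-edge (x∈p∪q⁺ (inj₁ (x∈⁅x⁆ i))))
    ...     | inj₁ i∈⁅j⁆ = x∈⁅y⁆⇒x≡y j i∈⁅j⁆
    ...     | inj₂ i∈⁅k⁆ = ⊥-elim (i≢k (x∈⁅y⁆⇒x≡y k i∈⁅k⁆))

    matching⇒dalmatianCondition : DalmatianCondition X ε
    matching⇒dalmatianCondition σ τ fσ fτ (k , k∈σ∩τ) i j i∈ j∈ =
      distance-2-blacks-≡ (adjacent-to-k i∈) (adjacent-to-k j∈)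
      where
      adjacent-to-k : ∀ {l} → l ∈ σ ∪ τ → Adjacent l k
      adjacent-to-k l∈ with x∈p∩q⁻ σ τ k∈σ∩τ | x∈p∪q⁻ σ τ l∈
      ... | k∈σ , _ | inj₁ l∈σ = face⇒Adjacent fσ l∈σ k∈σ
      ... | _ , k∈τ | inj₂ l∈τ = face⇒Adjacent fτ l∈τ k∈τ

  HasBlack : Subset m → Set
  HasBlack a = ∃ λ i → i ∈ a × black ε i ≡ true

  hasBlack? : ∀ a → Dec (HasBlack a)
  hasBlack? a = any? λ i → i ∈? a ×-dec black ε i Bool.≟ true

  height : Subset m → ℕ
  height a = penalty (hasBlack? a) + ∣ a ∣

  module _ (dalmatian : DalmatianCondition X ε) where

    blacks-in-face-≡ : face X a → i ∈ a → j ∈ a → black ε i ≡ true → black ε j ≡ true → i ≡ j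
    blacks-in-face-≡ {a} {i} {j} fa i∈a j∈a =
      dalmatian a a fa fa (i , x∈p∩q⁺ (i∈a , i∈a)) i j (x∈p∪q⁺ (inj₁ i∈a)) (x∈p∪q⁺ (inj₁ j∈a))

    dalmatian⇒matching : IsMatching (IEdge X ε)
    dalmatian⇒matching {a} {c = c}
      e₁@((fa , _ , _ , (x , x∈b) , b⊆a , _) , _) e₂@((fc , _ , _ , _ , d⊆c , _) , _) shared
      with IEdge⇒BlackFacet e₁ | IEdge⇒BlackFacet e₂
    ... | i , i∈a , bi , refl | j , j∈c , bj , refl
      with dalmatian a c fa fc (x , x∈p∩q⁺ (b⊆a x∈b , shareEndpoint⇒⊆ b⊆a d⊆c shared x∈b))
                     i j (x∈p∪q⁺ (inj₁ i∈a)) (x∈p∪q⁺ (inj₂ j∈c)) bi bj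
    ... | refl = a≡c , cong (_- i) a≡c
      where
      a≡c : a ≡ c
      a≡c = deletions-shareEndpoint⇒≡ i∈a j∈c shared

    unmatched-edge-lowers-height : PEdge X a b → ¬ IEdge X ε a b → height b < height a
    unmatched-edge-lowers-height {a} {b} e@(_ , _ , _ , _ , b⊆a , card) unmatched
      with hasBlack? a | hasBlack? b
    ... | yes _ | yes _ = ≤-reflexive card
    ... | yes (i , i∈a , bi) | no no-black =
      ⊥-elim (unmatched (e , from (∂h-coeff≡true⇔BlackFacet ε a b) (i , i∈a , bi , sym b≡a-i)))
      where
      b⊆a-i : b ⊆ a - i
      b⊆a-i x∈b = x∈p∧x≢y⇒x∈p-y (b⊆a x∈b) λ { refl → no-black (i , x∈b , bi) }
      b≡a-i : b ≡ a - i
      b≡a-i = p⊆q∧∣q∣≤∣p∣⇒p≡q b⊆a-i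
        (≤-reflexive (suc-injective (trans (x∈p⇒suc∣p-x∣≡∣p∣ i∈a) (sym card))))
    ... | no no-black | yes (j , j∈b , bj) = ⊥-elim (no-black (j , b⊆a j∈b , bj))
    ... | no _ | no _ = s≤s (s≤s (≤-reflexive card))

    matched-edge-raises-height : IEdge X ε b a → height b < height a
    matched-edge-raises-height {b} e@((fb , _ , _ , _ , _ , card) , _) with IEdge⇒BlackFacet e
    ... | i , i∈b , bi , refl with hasBlack? b | hasBlack? (b - i)
    ... | _ | yes (j , j∈b-i , bj) =
      ⊥-elim (x∈p-y⇒x≢y j∈b-i (blacks-in-face-≡ fb (p─q⊆p b ⁅ i ⁆ j∈b-i) i∈b bj bi))
    ... | yes _ | no _ = s≤s (≤-reflexive (sym card))
    ... | no no-black | no _ = ⊥-elim (no-black (i , i∈b , bi))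

    dalmatian⇒morse : IsMorseMatching X (IEdge X ε)
    dalmatian⇒morse = proj₁ , dalmatian⇒matching , <-measure⇒acyclic height reversed-step-lowers-height
      where
      reversed-step-lowers-height : ∀ {a b} → ReversedStep X (IEdge X ε) a b → height b < height a
      reversed-step-lowers-height (inj₁ (e , unmatched)) = unmatched-edge-lowers-height e unmatched
      reversed-step-lowers-height (inj₂ matched) = matched-edge-raises-height matched

theorem3p4 : (m : ℕ) (X : SimplicialComplex m) (ε : Colouring m) →
    ¬ (ε ≡ ⊥) →
    IsMorseMatching X (IEdge X ε) ⇔ Dalmatian X ε
theorem3p4 m X ε ε≢0 = mk⇔
  (λ (_ , matching , _) → ε≢0 , matching⇒dalmatianCondition X ε matching)
  (λ (_ , condition) → dalmatian⇒morse X ε condition)
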